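{- Let $L$ be a locale, $S$ a subset of $L$, $\mathcal F=\{f_i\}_{i\in I}$ a set-indexed family of continuous maps $f_i:L\to L_i$ with each $L_i$ compact and regular, $B_i$ a basis of $L_i$ that is a sub-pcd-lattice, $S_{\mathcal F}=S\cup\{f_i^-(b):i\in I,b\in B_i\}$, and $\lhd_{\mathcal F}$ the least relation on $S_{\mathcal F}^*$ containing $\{(f_i^-(b),f_i^-(a)):i\in I,\ a,b\in B_i,\ b\prec a\}$ and closed under conditions (1)–(5) of strong inclusions. Let $\lhd$ be a strong inclusion on $S_{\mathcal F}^*$ containing $\lhd_{\mathcal F}$. Then the map $\mu:L\to\mathcal R(S_{\mathcal F}^*,\lhd)$, $\mu^-(I)=\bigvee I$, is such that each $f_i$ factors uniquely through $\mu$: for every $i$ there is a unique continuous $g_i:\mathcal R(S_{\mathcal F}^*,\lhd)\to L_i$ with $g_i\circ\mu=f_i$.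
   Context: Framework: constructive set theory CZF + RRS-$\bigcup$REA (intuitionistic logic, no Powerset, Restricted Separation only). A locale $(L,B)$ is a class-frame with a set basis $B$ such that every $x$ is the join of the set $\{b\in B:b\le x\}$. $y^*=\bigvee\{c\in B:c\wedge y=0\}$; $y\prec x$ iff $1=x\vee y^*$. Regular: $a=\bigvee\{b\in B:b\prec a\}$ for $a\in B$; compact: every subset of $B$ with join $1$ has a finite subset with join $1$. A continuous map $f:L\to M$ is a function $f^-:B_M\to L$ with $\bigvee_{a\in B_M}f^-(a)=1$, $f^-(a)\wedge f^-(b)=\bigvee\{f^-(c):c\in B_M,c\le a,c\le b\}$, and $a\le\bigvee U\Rightarrow f^-(a)\le\bigvee_{b\in U}f^-(b)$; composition $(f\circ g)^-(a)=g^-[f^-(a)]$ with $g^-[x]=\bigvee\{g^-(b):b\le x\text{ basic}\}$. For $S\subseteq L$, $S^*$ is the least subset containing $S$ closed under $^*$ and finite meets and joins; a sub-pcd-lattice is a set closed under these. A strong inclusion on a pcd-lattice $P$ is a set-relation with: (1) $0\lhd0$, $1\lhd1$; (2) $x\le a\lhd b\le y\Rightarrow x\lhd y$; (3) $x\lhd a,x\lhd b\Rightarrow x\lhd a\wedge b$; (4) $x\lhd a,y\lhd a\Rightarrow x\vee y\lhd a$; (5) $a\lhd b\Rightarrow b^*\lhd a^*$; (6) $\lhd\subseteq\prec$; (7) $x\lhd y\Rightarrow x\lhd z\lhd y$ for some $z$. $\mathcal R(P,\lhd)$ is the locale of round ideals (ideals $I$ such that each $b\in I$ has $a\in I$ with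 $b\lhd a$) ordered by inclusion, with basis $\{\Downarrow a:a\in P\}$, $\Downarrow a=\{b:b\lhd a\}$; $\mu^-(\Downarrow a)=\bigvee_L\Downarrow a$. -}

module Defs where

open import Data.Product using (Σ; _×_; _,_; proj₁; proj₂)
open import Data.Sum using (_⊎_; inj₁; inj₂)
open import Data.Bool using (Bool; true; false; if_then_else_)
open import Data.Nat using (ℕ)
open import Data.Fin using (Fin)
open import Data.Unit using (⊤; tt)
open import Function using (_∘_)

-- Locales: class-frames (carrier in Set₁, i.e. a class) with a set basis.
-- Sets of CZF are modelled by types in Set; subsets/families of a class
-- are modelled by Set-indexed families.

record LocaleData : Set₂ where
  infix 4 _≤_
  infixr 7 _∧_
  field
    Carrier : Set₁
    _≤_ : Carrier → Carrier → Set
    top bot : Carrier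
    _∧_ : Carrier → Carrier → Carrier
    ⋁ : (J : Set) → (J → Carrier) → Carrier
    Basis : Set
    β : Basis → Carrier

module Ops (L : LocaleData) where
  open LocaleData L public
  infix 4 _≈_ _≺_
  infixr 6 _∨_
  infix 8 _*

  _≈_ : Carrier → Carrier → Set
  x ≈ y = (x ≤ y) × (y ≤ x)

  _∨_ : Carrier → Carrier → Carrier
  x ∨ y = ⋁ Bool (λ b → if b then x else y)

  _* : Carrier → Carrier
  y * = ⋁ (Σ Basis λ c → β c ∧ y ≈ bot) (β ∘ proj₁)

  _≺_ : Carrier → Carrier → Set
  y ≺ x = top ≈ x ∨ y *

record IsLocale (L : LocaleData) : Set₁ where
  open Ops L
  field
    ≤-refl : ∀ x → x ≤ x
    ≤-trans : ∀ {x y z} → x ≤ y → y ≤ z → x ≤ z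
    top-max : ∀ x → x ≤ top
    bot-min : ∀ x → bot ≤ x
    ∧-lb₁ : ∀ x y → x ∧ y ≤ x
    ∧-lb₂ : ∀ x y → x ∧ y ≤ y
    ∧-glb : ∀ {x y z} → z ≤ x → z ≤ y → z ≤ x ∧ y
    ⋁-ub : ∀ (J : Set) (f : J → Carrier) (j : J) → f j ≤ ⋁ J f
    ⋁-lub : ∀ (J : Set) (f : J → Carrier) (x : Carrier) → (∀ j → f j ≤ x) → ⋁ J f ≤ x
    distrib : ∀ x (J : Set) (f : J → Carrier) → x ∧ ⋁ J f ≤ ⋁ J (λ j → x ∧ f j)
    basis : ∀ x → x ≈ ⋁ (Σ Basis λ b → β b ≤ x) (β ∘ proj₁)

module _ (L : LocaleData) where
  open Ops L

  Regular : Set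
  Regular = ∀ (a : Basis) → β a ≈ ⋁ (Σ Basis λ b → β b ≺ β a) (β ∘ proj₁)

  Compact : Set₁
  Compact = ∀ (J : Set) (U : J → Basis) → top ≈ ⋁ J (β ∘ U) →
            Σ ℕ λ n → Σ (Fin n → J) λ k → top ≈ ⋁ (Fin n) (β ∘ U ∘ k)

  BasisIsSubPcd : Set
  BasisIsSubPcd =
      (Σ Basis λ c → β c ≈ bot)
    × (Σ Basis λ c → β c ≈ top)
    × (∀ a b → Σ Basis λ c → β c ≈ β a ∧ β b)
    × (∀ a b → Σ Basis λ c → β c ≈ β a ∨ β b)
    × (∀ a → Σ Basis λ c → β c ≈ β a *)

-- Continuous maps f : L → M, given by f⁻ : B_M → L

module _ (L M : LocaleData) where
  private
    module L = Ops L
    module M = Ops M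

  IsContinuous : (M.Basis → L.Carrier) → Set₁
  IsContinuous f =
      (L.top L.≈ L.⋁ M.Basis f)
    × (∀ a b → f a L.∧ f b L.≈
                L.⋁ (Σ M.Basis λ c → (M.β c M.≤ M.β a) × (M.β c M.≤ M.β b)) (f ∘ proj₁))
    × (∀ a (J : Set) (U : J → M.Basis) →
         M.β a M.≤ M.⋁ J (M.β ∘ U) → f a L.≤ L.⋁ J (f ∘ U))

  record ContMap : Set₁ where
    constructor contMap
    field
      fun : M.Basis → L.Carrier
      cont : IsContinuous fun

  MapEq : (M.Basis → L.Carrier) → (M.Basis → L.Carrier) → Set
  MapEq f g = ∀ a → f a L.≈ g a

open ContMap public

-- composition: for g : L → M and f : M → N,
-- (f ∘ g)⁻(a) = g⁻[f⁻(a)] = ⋁ { g⁻(b) : b ∈ B_M, b ≤ f⁻(a) }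
compose : (L M N : LocaleData) →
          (LocaleData.Basis N → LocaleData.Carrier M) →
          (LocaleData.Basis M → LocaleData.Carrier L) →
          LocaleData.Basis N → LocaleData.Carrier L
compose L M N f g a =
  LocaleData.⋁ L (Σ (LocaleData.Basis M) λ b → LocaleData._≤_ M (LocaleData.β M b) (f a))
                 (g ∘ proj₁)

-- S* : the least subset containing (the image of) a family v : G → L,
-- closed under *, finite meets and finite joins.  Its elements are
-- represented by terms, evaluated in L; the order is that of L.

data Term (G : Set) : Set where
  gen : G → Term G
  𝟎ₜ 𝟏ₜ : Term G
  _∧ₜ_ _∨ₜ_ : Term G → Term G → Term G
  _*ₜ : Term G → Term G

eval : (L : LocaleData) {G : Set} → (G → LocaleData.Carrier L) → Term G → LocaleData.Carrier L
eval L v (gen g) = v g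
eval L v 𝟎ₜ = LocaleData.bot L
eval L v 𝟏ₜ = LocaleData.top L
eval L v (x ∧ₜ y) = LocaleData._∧_ L (eval L v x) (eval L v y)
eval L v (x ∨ₜ y) = Ops._∨_ L (eval L v x) (eval L v y)
eval L v (x *ₜ) = Ops._* L (eval L v x)

module _ (L : LocaleData) {G : Set} (v : G → LocaleData.Carrier L) where
  private
    module L = Ops L
    ⟦_⟧ = eval L v

  record IsStrongInclusion (_◁_ : Term G → Term G → Set) : Set where
    field
      si1-0 : 𝟎ₜ ◁ 𝟎ₜ
      si1-1 : 𝟏ₜ ◁ 𝟏ₜ
      si2 : ∀ {x a b y} → ⟦ x ⟧ L.≤ ⟦ a ⟧ → a ◁ b → ⟦ b ⟧ L.≤ ⟦ y ⟧ → x ◁ y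
      si3 : ∀ {x a b} → x ◁ a → x ◁ b → x ◁ (a ∧ₜ b)
      si4 : ∀ {x y a} → x ◁ a → y ◁ a → (x ∨ₜ y) ◁ a
      si5 : ∀ {a b} → a ◁ b → (b *ₜ) ◁ (a *ₜ)
      si6 : ∀ {x y} → x ◁ y → ⟦ x ⟧ L.≺ ⟦ y ⟧
      si7 : ∀ {x y} → x ◁ y → Σ (Term G) λ z → (x ◁ z) × (z ◁ y)

  data Closure15 (R : Term G → Term G → Set) : Term G → Term G → Set where
    base : ∀ {x y} → R x y → Closure15 R x y
    c1-0 : Closure15 R 𝟎ₜ 𝟎ₜ
    c1-1 : Closure15 R 𝟏ₜ 𝟏ₜ
    c2 : ∀ {x a b y} → ⟦ x ⟧ L.≤ ⟦ a ⟧ → Closure15 R a b → ⟦ b ⟧ L.≤ ⟦ y ⟧ → Closure15 R x y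
    c3 : ∀ {x a b} → Closure15 R x a → Closure15 R x b → Closure15 R x (a ∧ₜ b)
    c4 : ∀ {x y a} → Closure15 R x a → Closure15 R y a → Closure15 R (x ∨ₜ y) a
    c5 : ∀ {a b} → Closure15 R a b → Closure15 R (b *ₜ) (a *ₜ)

module RoundIdeals (L : LocaleData) (isL : IsLocale L) {G : Set}
                   (v : G → LocaleData.Carrier L)
                   (_◁_ : Term G → Term G → Set)
                   (si : IsStrongInclusion L v _◁_) where
  private
    module L = Ops L
    module I = IsLocale isL
    module S = IsStrongInclusion si
    ⟦_⟧ = eval L v

  record IsRoundIdeal (P : Term G → Set) : Set where
    field
      ideal-0 : P 𝟎ₜ
      ideal-down : ∀ {x y} → ⟦ x ⟧ L.≤ ⟦ y ⟧ → P y → P x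
      ideal-∨ : ∀ {x y} → P x → P y → P (x ∨ₜ y)
      round : ∀ {x} → P x → Σ (Term G) λ y → P y × (x ◁ y)

  RI : Set₁
  RI = Σ (Term G → Set) IsRoundIdeal

  _⊆_ : RI → RI → Set
  P ⊆ Q = ∀ x → proj₁ P x → proj₁ Q x

  ⇓ : Term G → RI
  ⇓ a = (λ b → b ◁ a) , record
    { ideal-0 = S.si2 (I.bot-min _) S.si1-0 (I.bot-min _)
    ; ideal-down = λ x≤y y◁a → S.si2 x≤y y◁a (I.≤-refl _)
    ; ideal-∨ = S.si4
    ; round = λ b◁a → let (z , b◁z , z◁a) = S.si7 b◁a in z , z◁a , b◁z }

  topRI : RI
  topRI = (λ _ → ⊤) , record
    { ideal-0 = tt ; ideal-down = λ _ _ → tt ; ideal-∨ = λ _ _ → tt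
    ; round = λ _ → 𝟏ₜ , tt , S.si2 (I.top-max _) S.si1-1 (I.≤-refl _) }

  meetRI : RI → RI → RI
  meetRI (P , p) (Q , q) = (λ x → P x × Q x) , record
    { ideal-0 = p.ideal-0 , q.ideal-0
    ; ideal-down = λ le (a , b) → p.ideal-down le a , q.ideal-down le b
    ; ideal-∨ = λ (a , b) (c , d) → p.ideal-∨ a c , q.ideal-∨ b d
    ; round = λ (a , b) →
        let (y₁ , Py₁ , x◁y₁) = p.round a
            (y₂ , Qy₂ , x◁y₂) = q.round b
        in (y₁ ∧ₜ y₂) , (p.ideal-down (I.∧-lb₁ _ _) Py₁ , q.ideal-down (I.∧-lb₂ _ _) Qy₂)
                      , S.si3 x◁y₁ x◁y₂ }
    where
      module p = IsRoundIdeal p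
      module q = IsRoundIdeal q

  data Gen {J : Set} (F : J → RI) : Term G → Set where
    inc : ∀ {x} (j : J) → proj₁ (F j) x → Gen F x
    gzero : Gen F 𝟎ₜ
    gdown : ∀ {x y} → ⟦ x ⟧ L.≤ ⟦ y ⟧ → Gen F y → Gen F x
    gjoin : ∀ {x y} → Gen F x → Gen F y → Gen F (x ∨ₜ y)

  private
    ∨-inl : ∀ x y → x L.≤ x L.∨ y
    ∨-inl x y = I.⋁-ub Bool _ true
    ∨-inr : ∀ x y → y L.≤ x L.∨ y
    ∨-inr x y = I.⋁-ub Bool _ false

    gen-round : ∀ {J} {F : J → RI} {x} → Gen F x → Σ (Term G) λ y → Gen F y × (x ◁ y)
    gen-round {F = F} (inc j p) =
      let (y , Py , x◁y) = IsRoundIdeal.round (proj₂ (F j)) p in y , inc j Py , x◁y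
    gen-round gzero = 𝟎ₜ , gzero , S.si1-0
    gen-round (gdown le g) =
      let (y , gy , r) = gen-round g in y , gy , S.si2 le r (I.≤-refl _)
    gen-round (gjoin g h) =
      let (y₁ , g₁ , r₁) = gen-round g
          (y₂ , g₂ , r₂) = gen-round h
      in (y₁ ∨ₜ y₂) , gjoin g₁ g₂
         , S.si4 (S.si2 (I.≤-refl _) r₁ (∨-inl _ _)) (S.si2 (I.≤-refl _) r₂ (∨-inr _ _))

  joinRI : (J : Set) → (J → RI) → RI
  joinRI J F = Gen F , record
    { ideal-0 = gzero ; ideal-down = gdown ; ideal-∨ = gjoin ; round = gen-round }

  ℛ : LocaleData
  ℛ = record
    { Carrier = RI
    ; _≤_ = _⊆_
    ; top = topRI
    ; bot = ⇓ 𝟎ₜ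
    ; _∧_ = meetRI
    ; ⋁ = joinRI
    ; Basis = Term G
    ; β = ⇓ }

  μ⁻ : Term G → L.Carrier
  μ⁻ a = L.⋁ (Σ (Term G) λ b → b ◁ a) (⟦_⟧ ∘ proj₁)

module _ (L : LocaleData) (S : Set) (s : S → LocaleData.Carrier L)
         (I : Set) (Li : I → LocaleData) (f : (i : I) → ContMap L (Li i)) where

  GenF : Set
  GenF = S ⊎ Σ I (λ i → LocaleData.Basis (Li i))

  valF : GenF → LocaleData.Carrier L
  valF (inj₁ x) = s x
  valF (inj₂ (i , b)) = fun (f i) b

  data BaseF : Term GenF → Term GenF → Set where
    baseF : ∀ (i : I) (a b : LocaleData.Basis (Li i)) →
            Ops._≺_ (Li i) (LocaleData.β (Li i) b) (LocaleData.β (Li i) a) →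
            BaseF (gen (inj₂ (i , b))) (gen (inj₂ (i , a)))

  ◁F : Term GenF → Term GenF → Set
  ◁F = Closure15 L valF BaseF

{-# OPTIONS --safe #-}
-- The factor g_i sends a basic a to the round ideal generated by the f_i⁻(b) with b ≺ a.
-- It lies below f_i⁻(a) and, by regularity, its image under μ recovers f_i⁻(a).
-- It preserves meets because B_i is closed under ∧ and ≺ is, and covers because
-- compactness reduces b ≺ a ≤ ⋁ U to a finite join of generators.  Uniqueness: any
-- other factor g′ satisfies g′(a) ⊆ g(a) by regularity, and g(a) ⊆ g′(a) because
-- 1 ≤ a ∨ b* splits g′(1) into g′(a) and parts g′(d) with d ∧ b = 0, which are
-- annihilated by meeting with anything below f_i⁻(b).
module Submission where

open import Defs
open import Data.Product using (Σ; _×_; _,_; proj₁; proj₂)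
open import Data.Sum using (_⊎_; inj₁; inj₂; [_,_])
open import Data.Bool using (Bool; true; false)
open import Data.Nat using (ℕ; zero; suc)
open import Data.Fin using (Fin; zero; suc)
open import Data.Vec.Functional using (foldr)
open import Data.Unit using (⊤; tt)
open import Data.Empty using (⊥)
open import Function using (_∘_; const)

module FrameProperties (X : LocaleData) (isX : IsLocale X) where
  open Ops X public
  open IsLocale isX public

  x≤x∨y : ∀ x y → x ≤ x ∨ y
  x≤x∨y x y = ⋁-ub Bool _ true

  y≤x∨y : ∀ x y → y ≤ x ∨ y
  y≤x∨y x y = ⋁-ub Bool _ false

  ∨-least : ∀ {x y z} → x ≤ z → y ≤ z → x ∨ y ≤ z
  ∨-least {z = z} p q = ⋁-lub Bool _ z λ { true → p ; false → q }

  ∨-mono : ∀ {x y x′ y′} → x ≤ x′ → y ≤ y′ → x ∨ y ≤ x′ ∨ y′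
  ∨-mono p q = ∨-least (≤-trans p (x≤x∨y _ _)) (≤-trans q (y≤x∨y _ _))

  ∧-mono : ∀ {x y x′ y′} → x ≤ x′ → y ≤ y′ → x ∧ y ≤ x′ ∧ y′
  ∧-mono p q = ∧-glb (≤-trans (∧-lb₁ _ _) p) (≤-trans (∧-lb₂ _ _) q)

  ∧-comm : ∀ x y → x ∧ y ≤ y ∧ x
  ∧-comm x y = ∧-glb (∧-lb₂ x y) (∧-lb₁ x y)

  ∧-distribˡ-∨ : ∀ x y z → x ∧ (y ∨ z) ≤ (x ∧ y) ∨ (x ∧ z)
  ∧-distribˡ-∨ x y z =
    ≤-trans (distrib x Bool _) (⋁-lub Bool _ _ λ { true → x≤x∨y _ _ ; false → y≤x∨y _ _ })

  ∧-distribʳ-∨ : ∀ x y z → (y ∨ z) ∧ x ≤ (y ∧ x) ∨ (z ∧ x)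
  ∧-distribʳ-∨ x y z =
    ≤-trans (∧-comm _ _) (≤-trans (∧-distribˡ-∨ x y z) (∨-mono (∧-comm _ _) (∧-comm _ _)))

  ∧-⋁-least : ∀ {I J : Set} {f : I → Carrier} {g : J → Carrier} {z} →
              (∀ i j → f i ∧ g j ≤ z) → ⋁ I f ∧ ⋁ J g ≤ z
  ∧-⋁-least h = ≤-trans (distrib _ _ _) (⋁-lub _ _ _ λ j →
    ≤-trans (∧-comm _ _) (≤-trans (distrib _ _ _) (⋁-lub _ _ _ λ i →
      ≤-trans (∧-comm _ _) (h i j))))

  top≤⇒≤∧ : ∀ {x y} → top ≤ y → x ≤ x ∧ y
  top≤⇒≤∧ p = ∧-glb (≤-refl _) (≤-trans (top-max _) p)

  x∧x*≤bot : ∀ x → x ∧ x * ≤ bot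
  x∧x*≤bot x = ≤-trans (distrib x _ _) (⋁-lub _ _ bot λ (c , c∧x≈bot) →
    ≤-trans (∧-comm _ _) (proj₁ c∧x≈bot))

  *-antitone : ∀ {x y} → y ≤ x → x * ≤ y *
  *-antitone y≤x = ⋁-lub _ _ _ λ (c , c∧x≤bot , _) →
    ⋁-ub _ (β ∘ proj₁) (c , ≤-trans (∧-mono (≤-refl _) y≤x) c∧x≤bot , bot-min _)

  ≺⇒≤ : ∀ {x y} → y ≺ x → y ≤ x
  ≺⇒≤ (top≤x∨y* , _) = ≤-trans (top≤⇒≤∧ top≤x∨y*) (≤-trans (∧-distribˡ-∨ _ _ _)
    (∨-least (∧-lb₂ _ _) (≤-trans (x∧x*≤bot _) (bot-min _))))

  ≺-monoʳ : ∀ {x x′ y} → y ≺ x → x ≤ x′ → y ≺ x′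
  ≺-monoʳ (top≤x∨y* , _) x≤x′ = ≤-trans top≤x∨y* (∨-mono x≤x′ (≤-refl _)) , top-max _

  ≺-antitoneˡ : ∀ {x y y′} → y′ ≤ y → y ≺ x → y′ ≺ x
  ≺-antitoneˡ y′≤y (top≤x∨y* , _) =
    ≤-trans top≤x∨y* (∨-mono (≤-refl _) (*-antitone y′≤y)) , top-max _

  top≤⇒≺ : ∀ {x y} → top ≤ x → y ≺ x
  top≤⇒≺ top≤x = ≤-trans top≤x (x≤x∨y _ _) , top-max _

  ≺-∧ : ∀ {x x′ y y′} → y ≺ x → y′ ≺ x′ → y ∧ y′ ≺ x ∧ x′
  ≺-∧ {x} {x′} {y} {y′} (p , _) (p′ , _) = top≤ , top-max _
    where
      top≤ : top ≤ (x ∧ x′) ∨ (y ∧ y′) *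
      top≤ = ≤-trans
        (∧-glb (≤-trans p (∨-mono (≤-refl x) (*-antitone (∧-lb₁ y y′))))
               (≤-trans p′ (∨-mono (≤-refl x′) (*-antitone (∧-lb₂ y y′)))))
        (≤-trans (∧-distribˡ-∨ _ _ _) (∨-least
          (≤-trans (∧-comm _ _) (≤-trans (∧-distribˡ-∨ _ _ _) (∨-mono (∧-comm _ _) (∧-lb₂ _ _))))
          (≤-trans (∧-lb₂ _ _) (y≤x∨y _ _))))

  ≺-cover : ∀ {a b J} {U : J → Basis} → β b ≺ β a → β a ≤ ⋁ J (β ∘ U) →
            top ≤ ⋁ (J ⊎ Σ Basis λ c → β c ∧ β b ≈ bot) (β ∘ [ U , proj₁ ])
  ≺-cover (top≤a∨b* , _) a≤⋁U = ≤-trans top≤a∨b* (∨-least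
    (≤-trans a≤⋁U (⋁-lub _ _ _ λ j → ⋁-ub _ _ (inj₁ j)))
    (⋁-lub _ _ _ λ c → ⋁-ub _ _ (inj₂ c)))

  Refinement : {J : Set} → (J → Basis) → Set
  Refinement {J} U = Σ J λ j → Σ Basis λ d → β d ≺ β (U j)

  refine : {J : Set} (U : J → Basis) → Refinement U → Basis
  refine U = proj₁ ∘ proj₂

  regular-⋁ : Regular X → ∀ {J} (U : J → Basis) →
              ⋁ J (β ∘ U) ≤ ⋁ (Refinement U) (β ∘ refine U)
  regular-⋁ regular U = ⋁-lub _ _ _ λ j →
    ≤-trans (proj₁ (regular (U j))) (⋁-lub _ _ _ λ (d , d≺Uj) → ⋁-ub _ _ (j , d , d≺Uj))

module ContinuousMapProperties (L M : LocaleData) (isL : IsLocale L) (isM : IsLocale M)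
    (f⁻ : LocaleData.Basis M → LocaleData.Carrier L) (f-cont : IsContinuous L M f⁻) where
  private
    module L = FrameProperties L isL
    module M = FrameProperties M isM

  f⁻-covers : ∀ a (J : Set) (U : J → M.Basis) →
              M.β a M.≤ M.⋁ J (M.β ∘ U) → f⁻ a L.≤ L.⋁ J (f⁻ ∘ U)
  f⁻-covers = proj₂ (proj₂ f-cont)

  f⁻-mono : ∀ {a b} → M.β b M.≤ M.β a → f⁻ b L.≤ f⁻ a
  f⁻-mono {a} {b} b≤a =
    L.≤-trans (f⁻-covers b ⊤ (const a) (M.≤-trans b≤a (M.⋁-ub ⊤ _ tt)))
              (L.⋁-lub ⊤ _ _ λ _ → L.≤-refl _)

  f⁻-bot : ∀ {c} → M.β c M.≤ M.bot → f⁻ c L.≤ L.bot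
  f⁻-bot {c} c≤bot =
    L.≤-trans (f⁻-covers c ⊥ (λ ()) (M.≤-trans c≤bot (M.bot-min _))) (L.⋁-lub ⊥ _ _ λ ())

  f⁻-∧-least : ∀ {a b y} → (∀ c → M.β c M.≤ M.β a → M.β c M.≤ M.β b → f⁻ c L.≤ y) →
               f⁻ a L.∧ f⁻ b L.≤ y
  f⁻-∧-least {a} {b} h = L.≤-trans (proj₁ (proj₁ (proj₂ f-cont) a b))
    (L.⋁-lub _ _ _ λ (c , c≤a , c≤b) → h c c≤a c≤b)

  f⁻-disjoint : ∀ {b d} → M.β d M.∧ M.β b M.≈ M.bot → f⁻ b L.∧ f⁻ d L.≤ L.bot
  f⁻-disjoint d∧b≈bot = f⁻-∧-least λ c c≤b c≤d →
    f⁻-bot (M.≤-trans (M.∧-glb c≤d c≤b) (proj₁ d∧b≈bot))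

  f⁻-top : ∀ {t} → M.top M.≤ M.β t → L.top L.≤ f⁻ t
  f⁻-top top≤t = L.≤-trans (proj₁ (proj₁ f-cont))
    (L.⋁-lub _ _ _ λ b → f⁻-mono (M.≤-trans (M.top-max _) top≤t))

  f⁻-cover : ∀ {J} {U : J → M.Basis} → M.top M.≤ M.⋁ J (M.β ∘ U) → L.top L.≤ L.⋁ J (f⁻ ∘ U)
  f⁻-cover top≤⋁U = L.≤-trans (proj₁ (proj₁ f-cont))
    (L.⋁-lub _ _ _ λ c → f⁻-covers c _ _ (M.≤-trans (M.top-max _) top≤⋁U))

  f⁻-regular : Regular M → ∀ a → f⁻ a L.≤ L.⋁ (Σ M.Basis λ b → M.β b M.≺ M.β a) (f⁻ ∘ proj₁)
  f⁻-regular regular a = f⁻-covers a _ proj₁ (proj₁ (regular a))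

module RoundIdealProperties (L : LocaleData) (isL : IsLocale L) {G : Set}
    (v : G → LocaleData.Carrier L) (_◁_ : Term G → Term G → Set)
    (si : IsStrongInclusion L v _◁_) where
  open RoundIdeals L isL v _◁_ si public
  open FrameProperties L isL
  private
    module SI = IsStrongInclusion si

  ⟦_⟧ : Term G → Carrier
  ⟦_⟧ = eval L v

  _∈_ : Term G → RI → Set
  x ∈ P = proj₁ P x

  ∈-down : ∀ (P : RI) {x y} → ⟦ x ⟧ ≤ ⟦ y ⟧ → y ∈ P → x ∈ P
  ∈-down P = IsRoundIdeal.ideal-down (proj₂ P)

  ◁⇒≤ : ∀ {x y} → x ◁ y → ⟦ x ⟧ ≤ ⟦ y ⟧
  ◁⇒≤ = ≺⇒≤ ∘ SI.si6

  ≤-◁ : ∀ {x a y} → ⟦ x ⟧ ≤ ⟦ a ⟧ → a ◁ y → x ◁ y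
  ≤-◁ {x} {a} {y} x≤a a◁y = SI.si2 {x} {a} {y} {y} x≤a a◁y (≤-refl _)

  ◁-≤ : ∀ {x a y} → x ◁ a → ⟦ a ⟧ ≤ ⟦ y ⟧ → x ◁ y
  ◁-≤ {x} {a} {y} x◁a a≤y = SI.si2 {x} {x} {a} {y} (≤-refl _) x◁a a≤y

  ◁-∧-mono : ∀ {x y a b} → x ◁ a → y ◁ b → (x ∧ₜ y) ◁ (a ∧ₜ b)
  ◁-∧-mono {x} {y} x◁a y◁b =
    SI.si3 (≤-◁ {x ∧ₜ y} {x} (∧-lb₁ _ _) x◁a) (≤-◁ {x ∧ₜ y} {y} (∧-lb₂ _ _) y◁b)

  record IsIdeal (P : Term G → Set) : Set where
    field
      ideal-0 : P 𝟎ₜ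
      ideal-down : ∀ {x y} → ⟦ x ⟧ ≤ ⟦ y ⟧ → P y → P x
      ideal-∨ : ∀ {x y} → P x → P y → P (x ∨ₜ y)

  RI-isIdeal : (P : RI) → IsIdeal (_∈ P)
  RI-isIdeal (_ , isRI) = record { IsRoundIdeal isRI }

  ≤-isIdeal : ∀ y → IsIdeal (λ x → ⟦ x ⟧ ≤ y)
  ≤-isIdeal y = record
    { ideal-0 = bot-min y ; ideal-down = ≤-trans ; ideal-∨ = ∨-least }

  ∧ˡ-section : ∀ x {P} → IsIdeal P → IsIdeal (λ z → P (x ∧ₜ z))
  ∧ˡ-section x isP = record
    { ideal-0 = ideal-down (∧-lb₂ _ _) ideal-0
    ; ideal-down = λ z≤y → ideal-down (∧-mono (≤-refl _) z≤y)
    ; ideal-∨ = λ p q → ideal-down (∧-distribˡ-∨ _ _ _) (ideal-∨ p q) }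
    where open IsIdeal isP

  ∧ʳ-section : ∀ y {P} → IsIdeal P → IsIdeal (λ z → P (z ∧ₜ y))
  ∧ʳ-section y isP = record
    { ideal-0 = ideal-down (∧-lb₁ _ _) ideal-0
    ; ideal-down = λ z≤x → ideal-down (∧-mono z≤x (≤-refl _))
    ; ideal-∨ = λ p q → ideal-down (∧-distribʳ-∨ _ _ _) (ideal-∨ p q) }
    where open IsIdeal isP

  ⋂-isIdeal : ∀ {J : Set} {P : J → Term G → Set} →
              (∀ j → IsIdeal (P j)) → IsIdeal (λ x → ∀ j → P j x)
  ⋂-isIdeal isP = record
    { ideal-0 = λ j → IsIdeal.ideal-0 (isP j)
    ; ideal-down = λ x≤y p j → IsIdeal.ideal-down (isP j) x≤y (p j)
    ; ideal-∨ = λ p q j → IsIdeal.ideal-∨ (isP j) (p j) (q j) }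

  Gen-least : ∀ {J} {F : J → RI} {P} → IsIdeal P →
              (∀ j x → x ∈ F j → P x) → ∀ x → Gen F x → P x
  Gen-least isP h x (inc j x∈Fj) = h j x x∈Fj
  Gen-least isP h _ gzero = IsIdeal.ideal-0 isP
  Gen-least isP h x (gdown x≤y y∈) = IsIdeal.ideal-down isP x≤y (Gen-least isP h _ y∈)
  Gen-least isP h _ (gjoin x∈ y∈) = IsIdeal.ideal-∨ isP (Gen-least isP h _ x∈) (Gen-least isP h _ y∈)

  ⋁ℛ-least : ∀ {J} {F : J → RI} (Q : RI) → (∀ j → F j ⊆ Q) → joinRI J F ⊆ Q
  ⋁ℛ-least Q = Gen-least (RI-isIdeal Q)

  ⋁ₜ : ∀ {n} → (Fin n → Term G) → Term G
  ⋁ₜ = foldr _∨ₜ_ 𝟎ₜ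

  ⋁≤⟦⋁ₜ⟧ : ∀ {n} (t : Fin n → Term G) → ⋁ (Fin n) (⟦_⟧ ∘ t) ≤ ⟦ ⋁ₜ t ⟧
  ⋁≤⟦⋁ₜ⟧ {zero} t = ⋁-lub _ _ _ λ ()
  ⋁≤⟦⋁ₜ⟧ {suc n} t = ⋁-lub _ _ _ λ
    { zero → x≤x∨y _ _
    ; (suc m) → ≤-trans (≤-trans (⋁-ub _ _ m) (⋁≤⟦⋁ₜ⟧ (t ∘ suc))) (y≤x∨y _ _) }

  ⋁ₜ-closed : ∀ {P} → IsIdeal P → ∀ {n} (t : Fin n → Term G) → (∀ m → P (t m)) → P (⋁ₜ t)
  ⋁ₜ-closed isP {zero} t _ = IsIdeal.ideal-0 isP
  ⋁ₜ-closed isP {suc n} t h = IsIdeal.ideal-∨ isP (h zero) (⋁ₜ-closed isP (t ∘ suc) (h ∘ suc))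

  ◁⇒≤μ⁻ : ∀ {x c} → x ◁ c → ⟦ x ⟧ ≤ μ⁻ c
  ◁⇒≤μ⁻ {x} x◁c = ⋁-ub _ (⟦_⟧ ∘ proj₁) (x , x◁c)

  μ⁻-mono : ∀ {c d} → ⇓ c ⊆ ⇓ d → μ⁻ c ≤ μ⁻ d
  μ⁻-mono c⊆d = ⋁-lub _ _ _ λ (x , x◁c) → ◁⇒≤μ⁻ (c⊆d x x◁c)

  μ⁻-continuous : IsContinuous L ℛ μ⁻
  μ⁻-continuous = preserves-top , preserves-∧ , preserves-covers
    where
      preserves-top : top ≈ ⋁ (Term G) μ⁻
      preserves-top = ≤-trans (◁⇒≤μ⁻ SI.si1-1) (⋁-ub _ μ⁻ 𝟏ₜ) , top-max _

      ◁-interpolate-∧ : ∀ {a b x y} → x ◁ a → y ◁ b →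
        ⟦ x ∧ₜ y ⟧ ≤ ⋁ (Σ (Term G) λ c → (⇓ c ⊆ ⇓ a) × (⇓ c ⊆ ⇓ b)) (μ⁻ ∘ proj₁)
      ◁-interpolate-∧ x◁a y◁b with SI.si7 x◁a | SI.si7 y◁b
      ... | x′ , x◁x′ , x′◁a | y′ , y◁y′ , y′◁b = ≤-trans
        (◁⇒≤μ⁻ (◁-∧-mono x◁x′ y◁y′))
        (⋁-ub _ (μ⁻ ∘ proj₁) (x′ ∧ₜ y′
          , (λ w w◁ → ≤-◁ (≤-trans (◁⇒≤ w◁) (∧-lb₁ _ _)) x′◁a)
          , (λ w w◁ → ≤-◁ (≤-trans (◁⇒≤ w◁) (∧-lb₂ _ _)) y′◁b)))

      preserves-∧ : ∀ a b → μ⁻ a ∧ μ⁻ b ≈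
        ⋁ (Σ (Term G) λ c → (⇓ c ⊆ ⇓ a) × (⇓ c ⊆ ⇓ b)) (μ⁻ ∘ proj₁)
      preserves-∧ a b =
          ∧-⋁-least (λ (x , x◁a) (y , y◁b) → ◁-interpolate-∧ x◁a y◁b)
        , ∧-glb (⋁-lub _ _ _ λ (c , c⊆a , _) → μ⁻-mono c⊆a)
                (⋁-lub _ _ _ λ (c , _ , c⊆b) → μ⁻-mono c⊆b)

      preserves-covers : ∀ a (J : Set) (U : J → Term G) →
        ⇓ a ⊆ joinRI J (⇓ ∘ U) → μ⁻ a ≤ ⋁ J (μ⁻ ∘ U)
      preserves-covers a J U a⊆⋁U = ⋁-lub _ _ _ λ (x , x◁a) →
        Gen-least (≤-isIdeal _) (λ j w w◁Uj → ≤-trans (◁⇒≤μ⁻ w◁Uj) (⋁-ub J (μ⁻ ∘ U) j))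
          x (a⊆⋁U x x◁a)

  module Factorisation (M : LocaleData) (isM : IsLocale M)
      (compact : Compact M) (regular : Regular M) (pcd : BasisIsSubPcd M)
      (emb : LocaleData.Basis M → Term G)
      (f-cont : IsContinuous L M (⟦_⟧ ∘ emb))
      (emb-◁ : ∀ {a b} → Ops._≺_ M (LocaleData.β M b) (LocaleData.β M a) → emb b ◁ emb a)
      where
    private
      module M = FrameProperties M isM
    open ContinuousMapProperties L M isL isM (⟦_⟧ ∘ emb) f-cont

    f⁻ : M.Basis → Carrier
    f⁻ = ⟦_⟧ ∘ emb

    g⁻ : M.Basis → RI
    g⁻ a = joinRI (Σ M.Basis λ b → M.β b M.≺ M.β a) (⇓ ∘ emb ∘ proj₁)

    g⁻-bound : ∀ a x → x ∈ g⁻ a → ⟦ x ⟧ ≤ f⁻ a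
    g⁻-bound a = Gen-least (≤-isIdeal _) λ (b , b≺a) x x◁b →
      ≤-trans (◁⇒≤ x◁b) (f⁻-mono (M.≺⇒≤ b≺a))

    g⁻-mono : ∀ {a c} → M.β c M.≤ M.β a → g⁻ c ⊆ g⁻ a
    g⁻-mono {a} c≤a = ⋁ℛ-least (g⁻ a) λ (b , b≺c) x x◁b → inc (b , M.≺-monoʳ b≺c c≤a) x◁b

    _⊓_ : M.Basis → M.Basis → M.Basis
    a ⊓ b = proj₁ (proj₁ (proj₂ (proj₂ pcd)) a b)

    ⊓-≈ : ∀ a b → M.β (a ⊓ b) M.≈ M.β a M.∧ M.β b
    ⊓-≈ a b = proj₂ (proj₁ (proj₂ (proj₂ pcd)) a b)

    ◁emb-⊓ : ∀ {x y b₁ b₂} → x ◁ emb b₁ → y ◁ emb b₂ → (x ∧ₜ y) ◁ emb (b₁ ⊓ b₂)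
    ◁emb-⊓ {b₁ = b₁} {b₂} x◁b₁ y◁b₂ = ◁-≤ (◁-∧-mono x◁b₁ y◁b₂)
      (f⁻-∧-least λ c c≤b₁ c≤b₂ → f⁻-mono (M.≤-trans (M.∧-glb c≤b₁ c≤b₂) (proj₂ (⊓-≈ b₁ b₂))))

    ⊓-≺ : ∀ {a b b₁ b₂} → M.β b₁ M.≺ M.β a → M.β b₂ M.≺ M.β b → M.β (b₁ ⊓ b₂) M.≺ M.β (a ⊓ b)
    ⊓-≺ {a} {b} {b₁} {b₂} b₁≺a b₂≺b =
      M.≺-monoʳ (M.≺-antitoneˡ (proj₁ (⊓-≈ b₁ b₂)) (M.≺-∧ b₁≺a b₂≺b)) (proj₂ (⊓-≈ a b))

    ◁emb-∧-∈ : ∀ {a b b₁ x} → M.β b₁ M.≺ M.β a → x ◁ emb b₁ →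
               ∀ y → y ∈ g⁻ b → (x ∧ₜ y) ∈ g⁻ (a ⊓ b)
    ◁emb-∧-∈ {a} {b} {x = x} b₁≺a x◁b₁ = Gen-least (∧ˡ-section x (RI-isIdeal (g⁻ (a ⊓ b))))
      λ (b₂ , b₂≺b) y y◁b₂ → inc (_ , ⊓-≺ b₁≺a b₂≺b) (◁emb-⊓ x◁b₁ y◁b₂)

    g⁻-∧ : ∀ a b x → x ∈ g⁻ a → ∀ y → y ∈ g⁻ b → (x ∧ₜ y) ∈ g⁻ (a ⊓ b)
    g⁻-∧ a b x x∈a y y∈b =
      Gen-least (⋂-isIdeal λ ((y , _) : Σ (Term G) (_∈ g⁻ b)) → ∧ʳ-section y (RI-isIdeal (g⁻ (a ⊓ b))))
        (λ (b₁ , b₁≺a) x x◁b₁ (y , y∈b) → ◁emb-∧-∈ b₁≺a x◁b₁ y y∈b)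
        x x∈a (y , y∈b)

    module _ {J : Set} (U : J → M.Basis) where
      -- Interpolating twice puts every f⁻(d) with d ≺ d′ ≺ U j inside the round ideal g⁻(U j).
      Fine : Set
      Fine = M.Refinement (M.refine U)

      fine : Fine → M.Basis
      fine = M.refine (M.refine U)

      fine-∈ : ∀ κ → emb (fine κ) ∈ joinRI J (g⁻ ∘ U)
      fine-∈ ((j , d′ , d′≺Uj) , d , d≺d′) = inc j (inc (d′ , d′≺Uj) (emb-◁ d≺d′))

      ◁emb-∈-⋁ : ∀ {a b x} → M.β b M.≺ M.β a → M.β a M.≤ M.⋁ J (M.β ∘ U) →
                 x ◁ emb b → x ∈ joinRI J (g⁻ ∘ U)
      ◁emb-∈-⋁ {a} {b} {x} b≺a a≤⋁U x◁b = finish (compact K V (K-covers , M.top-max _))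
        where
          K : Set
          K = Fine ⊎ Σ M.Basis λ c → M.β c M.∧ M.β b M.≈ M.bot

          V : K → M.Basis
          V = [ fine , proj₁ ]

          K-covers : M.top M.≤ M.⋁ K (M.β ∘ V)
          K-covers = M.≺-cover b≺a
            (M.≤-trans a≤⋁U (M.≤-trans (M.regular-⋁ regular U) (M.regular-⋁ regular (M.refine U))))

          t : K → Term G
          t = [ emb ∘ fine , const 𝟎ₜ ]

          t-∈ : ∀ κ → t κ ∈ joinRI J (g⁻ ∘ U)
          t-∈ (inj₁ κ) = fine-∈ κ
          t-∈ (inj₂ _) = gzero

          b∧V≤t : ∀ κ → f⁻ b ∧ f⁻ (V κ) ≤ ⟦ t κ ⟧
          b∧V≤t (inj₁ κ) = ∧-lb₂ _ _
          b∧V≤t (inj₂ (c , c∧b≈bot)) = f⁻-disjoint c∧b≈bot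

          finish : (Σ ℕ λ n → Σ (Fin n → K) λ k → M.top M.≈ M.⋁ (Fin n) (M.β ∘ V ∘ k)) →
                   x ∈ joinRI J (g⁻ ∘ U)
          finish (n , k , top≈⋁Vk) =
            gdown x≤⋁t (⋁ₜ-closed (RI-isIdeal (joinRI J (g⁻ ∘ U))) (t ∘ k) (t-∈ ∘ k))
            where
              x≤⋁t : ⟦ x ⟧ ≤ ⟦ ⋁ₜ (t ∘ k) ⟧
              x≤⋁t = ≤-trans (◁⇒≤ x◁b) (≤-trans (top≤⇒≤∧ (f⁻-cover (proj₁ top≈⋁Vk)))
                (≤-trans (distrib _ _ _) (≤-trans
                  (⋁-lub _ _ _ λ m → ≤-trans (b∧V≤t (k m)) (⋁-ub _ (⟦_⟧ ∘ t ∘ k) m))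
                  (⋁≤⟦⋁ₜ⟧ (t ∘ k)))))

    g⁻-covers : ∀ a (J : Set) (U : J → M.Basis) →
                M.β a M.≤ M.⋁ J (M.β ∘ U) → g⁻ a ⊆ joinRI J (g⁻ ∘ U)
    g⁻-covers a J U a≤⋁U = ⋁ℛ-least (joinRI J (g⁻ ∘ U)) λ (b , b≺a) x → ◁emb-∈-⋁ U b≺a a≤⋁U

    g⁻-continuous : IsContinuous ℛ M g⁻
    g⁻-continuous = preserves-top , preserves-∧ , g⁻-covers
      where
        ⊤B : M.Basis
        ⊤B = proj₁ (proj₁ (proj₂ pcd))

        ⊤B≈top : M.β ⊤B M.≈ M.top
        ⊤B≈top = proj₂ (proj₁ (proj₂ pcd))

        ⊤B≺⊤B : M.β ⊤B M.≺ M.β ⊤B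
        ⊤B≺⊤B = M.top≤⇒≺ (proj₂ ⊤B≈top)

        preserves-top : Ops._≈_ ℛ topRI (joinRI M.Basis g⁻)
        preserves-top =
            (λ x _ → inc ⊤B (inc (⊤B , ⊤B≺⊤B)
              (≤-◁ (≤-trans (top-max _) (f⁻-top (proj₂ ⊤B≈top))) (emb-◁ ⊤B≺⊤B))))
          , (λ _ _ → tt)

        preserves-∧ : ∀ a b → Ops._≈_ ℛ (meetRI (g⁻ a) (g⁻ b))
          (joinRI (Σ M.Basis λ c → (M.β c M.≤ M.β a) × (M.β c M.≤ M.β b)) (g⁻ ∘ proj₁))
        preserves-∧ a b =
            (λ x (x∈a , x∈b) →
              inc (a ⊓ b , M.≤-trans (proj₁ (⊓-≈ a b)) (M.∧-lb₁ _ _)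
                         , M.≤-trans (proj₁ (⊓-≈ a b)) (M.∧-lb₂ _ _))
                  (∈-down (g⁻ (a ⊓ b)) (∧-glb (≤-refl _) (≤-refl _)) (g⁻-∧ a b x x∈a x x∈b)))
          , (λ x x∈ → ⋁ℛ-least (g⁻ a) (λ (c , c≤a , _) → g⁻-mono c≤a) x x∈
                    , ⋁ℛ-least (g⁻ b) (λ (c , _ , c≤b) → g⁻-mono c≤b) x x∈)

    g⁻∘μ⁻≈f⁻ : MapEq L M (compose L ℛ M g⁻ μ⁻) f⁻
    g⁻∘μ⁻≈f⁻ a =
        (⋁-lub _ _ _ λ (c , c⊆a) → ⋁-lub _ _ _ λ (x , x◁c) → g⁻-bound a x (c⊆a x x◁c))
      , ≤-trans (f⁻-regular regular a) (⋁-lub _ _ _ λ (b , b≺a) →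
          ≤-trans (f⁻-regular regular b) (⋁-lub _ _ _ λ (d , d≺b) →
            ≤-trans (◁⇒≤μ⁻ (emb-◁ d≺b)) (⋁-ub _ (μ⁻ ∘ proj₁) (emb b , λ x → inc (b , b≺a)))))

    module _ (g′ : ContMap ℛ M) (g′∘μ⁻≈f⁻ : MapEq L M (compose L ℛ M (fun g′) μ⁻) f⁻) where
      private
        g′⁻ = fun g′

      g′-bound : ∀ d z → z ∈ g′⁻ d → ⟦ z ⟧ ≤ f⁻ d
      g′-bound d z z∈ with IsRoundIdeal.round (proj₂ (g′⁻ d)) z∈
      ... | y , y∈ , z◁y = ≤-trans (◁⇒≤μ⁻ z◁y) (≤-trans
        (⋁-ub _ (μ⁻ ∘ proj₁) (y , λ w w◁y → ∈-down (g′⁻ d) (◁⇒≤ w◁y) y∈))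
        (proj₁ (g′∘μ⁻≈f⁻ d)))

      g′⊆g⁻ : ∀ a → g′⁻ a ⊆ g⁻ a
      g′⊆g⁻ a x x∈ = ⋁ℛ-least (g⁻ a) below-g⁻ x
        (proj₂ (proj₂ (cont g′)) a _ proj₁ (proj₁ (regular a)) x x∈)
        where
          below-g⁻ : ∀ ((b , _) : Σ M.Basis λ b → M.β b M.≺ M.β a) → g′⁻ b ⊆ g⁻ a
          below-g⁻ (b , b≺a) z z∈ with IsRoundIdeal.round (proj₂ (g′⁻ b)) z∈
          ... | y , y∈ , z◁y = inc (b , b≺a) (◁-≤ z◁y (g′-bound b y y∈))

      g⁻⊆g′ : ∀ a → g⁻ a ⊆ g′⁻ a
      g⁻⊆g′ a = ⋁ℛ-least (g′⁻ a) λ (b , b≺a) x x◁b → ∈-down (g′⁻ a) (top≤⇒≤∧ (≤-refl _))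
        (Gen-least (∧ˡ-section x (RI-isIdeal (g′⁻ a))) (◁emb-∧-∈-g′ b≺a x◁b) 𝟏ₜ
          (proj₁ (proj₁ (cont g′)) 𝟏ₜ tt))
        where
          ◁emb-∧-∈-g′ : ∀ {b x} → M.β b M.≺ M.β a → x ◁ emb b → ∀ c z → z ∈ g′⁻ c → (x ∧ₜ z) ∈ g′⁻ a
          ◁emb-∧-∈-g′ {b} {x} b≺a x◁b c z z∈ = Gen-least (∧ˡ-section x (RI-isIdeal (g′⁻ a)))
            (λ { (inj₁ _) z z∈a → ∈-down (g′⁻ a) (∧-lb₂ _ _) z∈a
               ; (inj₂ (d , d∧b≈bot)) z z∈d → ∈-down (g′⁻ a)
                   (≤-trans (∧-mono (◁⇒≤ x◁b) (g′-bound d z z∈d)) (f⁻-disjoint d∧b≈bot))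
                   (IsRoundIdeal.ideal-0 (proj₂ (g′⁻ a))) })
            z (proj₂ (proj₂ (cont g′)) c _ [ const a , proj₁ ]
                (M.≤-trans (M.top-max _) (M.≺-cover b≺a (M.⋁-ub ⊤ _ tt))) z z∈)

      g⁻-unique : MapEq ℛ M g′⁻ g⁻
      g⁻-unique a = g′⊆g⁻ a , g⁻⊆g′ a

proposition4p5 :
  (L : LocaleData) (isL : IsLocale L)
  (S : Set) (s : S → LocaleData.Carrier L)
  (I : Set) (Li : I → LocaleData)
  (isLi : (i : I) → IsLocale (Li i))
  (compactLi : (i : I) → Compact (Li i))
  (regularLi : (i : I) → Regular (Li i))
  (pcdBi : (i : I) → BasisIsSubPcd (Li i))
  (f : (i : I) → ContMap L (Li i))
  (_◁_ : Term (GenF L S s I Li f) → Term (GenF L S s I Li f) → Set)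
  (si : IsStrongInclusion L (valF L S s I Li f) _◁_)
  (contains : ∀ x y → ◁F L S s I Li f x y → x ◁ y) →
  IsContinuous L (RoundIdeals.ℛ L isL (valF L S s I Li f) _◁_ si)
                 (RoundIdeals.μ⁻ L isL (valF L S s I Li f) _◁_ si)
  × ((i : I) →
       Σ (ContMap (RoundIdeals.ℛ L isL (valF L S s I Li f) _◁_ si) (Li i)) λ g →
         MapEq L (Li i)
           (compose L (RoundIdeals.ℛ L isL (valF L S s I Li f) _◁_ si) (Li i)
              (fun g) (RoundIdeals.μ⁻ L isL (valF L S s I Li f) _◁_ si))
           (fun (f i))
         × ((g′ : ContMap (RoundIdeals.ℛ L isL (valF L S s I Li f) _◁_ si) (Li i)) →
              MapEq L (Li i)
                (compose L (RoundIdeals.ℛ L isL (valF L S s I Li f) _◁_ si) (Li i)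
                   (fun g′) (RoundIdeals.μ⁻ L isL (valF L S s I Li f) _◁_ si))
                (fun (f i)) →
              MapEq (RoundIdeals.ℛ L isL (valF L S s I Li f) _◁_ si) (Li i)
                (fun g′) (fun g)))
proposition4p5 L isL S s I Li isLi compactLi regularLi pcdBi f _◁_ si contains =
  μ⁻-continuous , λ i →
    let open Factorisation (Li i) (isLi i) (compactLi i) (regularLi i) (pcdBi i)
                           (λ b → gen (inj₂ (i , b))) (cont (f i))
                           (λ {a} {b} b≺a → contains _ _ (base (baseF i a b b≺a)))
    in contMap g⁻ g⁻-continuous , g⁻∘μ⁻≈f⁻ , g⁻-unique
  where open RoundIdealProperties L isL (valF L S s I Li f) _◁_ si
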